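{- Let $N=(S,T,F,M_0)$ be a binary-conflict-free net, $\sigma,\rho_1,\rho_2\in T^*$ and $t\in T$ such that $t$ does not occur in $\rho_1$. If $\sigma t\in\mathrm{FS}(N)$ and $\sigma\rho_1t\rho_2\in\mathrm{FS}(N)$, then $\sigma t\rho_1\rho_2\in\mathrm{FS}(N)$ and $\sigma t\rho_1\rho_2\equiv_0^*\sigma\rho_1t\rho_2$.
   Context: A net is $N=(S,T,F,M_0)$ with $S,T$ disjoint, $F:(S\times T)\cup(T\times S)\to\mathbb{N}$, $M_0:S\to\mathbb{N}$, each transition having finitely many and at least one preplace and finitely many postplaces. ${}^\bullet x(y)=F(y,x)$, $x^\bullet(y)=F(x,y)$ (multisets), extended additively to finite multisets. For markings $M,M'$ and finite non-empty multiset $G$ of transitions, $M\xrightarrow{G}M'$ iff ${}^\bullet G\le M$ and $M'=(M-{}^\bullet G)+G^\bullet$. For a finite or infinite word $\sigma=t_1t_2\cdots$, $M\xrightarrow{\sigma}$ means $M\xrightarrow{\{t_1\}}M_1\xrightarrow{\{t_2\}}\cdots$. $\mathrm{FS}^\infty(N)$: words with $M_0\xrightarrow{\sigma}$; $\mathrm{FS}(N)$: finite ones; reachable markings are those $M$ with $M_0\xrightarrow{\sigma}M$ for some finite $\sigma$. A finite non-empty multiset $G$ of transitions is in semantic conflict in $M$ iff not $M\xrightarrow{G}$ but $M\xrightarrow{G\restriction\{t\}}$ for every $t\in G$; $N$ is binary-conflict-free iff no $G$ with $|G|=2$ is in semantic conflict in any reachable marking. For $\sigma,\rho\in\mathrm{FS}^\infty(N)$,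 $\sigma\equiv_0\rho$ iff $\sigma=\alpha tu\beta$, $\rho=\alpha ut\beta$ and $M_0\xrightarrow{\alpha}M\xrightarrow{\{t,u\}}$ for some $M$; $\equiv_0^*$ is its reflexive transitive closure. -}

module Defs where

open import Data.Nat using (ℕ; zero; suc; _+_; _∸_; _≤_; _>_)
open import Data.List using (List; []; _∷_; _++_; map; [_])
open import Data.Nat.ListAction using (sum)
open import Relation.Nullary using (¬_)
open import Data.List.Membership.Propositional using (_∈_)
open import Data.List.Relation.Unary.Any using (Any)
open import Data.Product using (Σ; ∃; _×_; _,_)
open import Relation.Binary.PropositionalEquality using (_≡_; _≢_)
open import Relation.Binary.Construct.Closure.ReflexiveTransitive using (Star)

-- F is split into its two halves
-- Fin : S × T → ℕ   (F(s,t), arcs place → transition)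
-- Fout : T × S → ℕ  (F(t,s), arcs transition → place).
-- S and T are disjoint by construction (separate types).
record Net : Set₁ where
  field
    S    : Set
    T    : Set
    Fin  : S → T → ℕ
    Fout : T → S → ℕ
    M₀   : S → ℕ
    pre-finite  : ∀ t → ∃ λ (ss : List S) → ∀ s → Fin s t > 0 → s ∈ ss
    post-finite : ∀ t → ∃ λ (ss : List S) → ∀ s → Fout t s > 0 → s ∈ ss
    pre-nonempty : ∀ t → ∃ λ s → Fin s t > 0

module _ (N : Net) where
  open Net N

  Marking : Set
  Marking = S → ℕ

  -- A finite multiset of transitions, represented by a list (order irrelevant).
  -- Preset / postset, extended additively.
  preG : List T → S → ℕ
  preG G s = sum (map (λ t → Fin s t) G)

  postG : List T → S → ℕ
  postG G s = sum (map (λ t → Fout t s) G)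

  Enabled : Marking → List T → Set
  Enabled M G = ∀ s → preG G s ≤ M s

  fire : Marking → List T → Marking
  fire M G s = (M s ∸ preG G s) + postG G s

  data Fires : Marking → List T → Marking → Set where
    done : ∀ {M} → Fires M [] M
    step : ∀ {M M' t σ} → Enabled M [ t ] → Fires (fire M [ t ]) σ M' → Fires M (t ∷ σ) M'

  FS : List T → Set
  FS σ = ∃ λ M → Fires M₀ σ M

  Reachable : Marking → Set
  Reachable M = ∃ λ σ → Fires M₀ σ M

  -- A two-element multiset G = {t,u} with t = u is
  -- never in semantic conflict (G↾{t} = G); for t ≠ u we have G↾{t} = {t},
  -- G↾{u} = {u}, so "no G with |G| = 2 in semantic conflict" unfolds to:
  BinaryConflictFree : Set
  BinaryConflictFree = ∀ M → Reachable M → ∀ t u → t ≢ u →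
    Enabled M [ t ] → Enabled M [ u ] → Enabled M (t ∷ u ∷ [])

  data _≡₀_ : List T → List T → Set where
    swap : ∀ α t u β M → FS (α ++ t ∷ u ∷ β) → FS (α ++ u ∷ t ∷ β) →
           Fires M₀ α M → Enabled M (t ∷ u ∷ []) →
           (α ++ t ∷ u ∷ β) ≡₀ (α ++ u ∷ t ∷ β)

  _≡₀*_ : List T → List T → Set
  _≡₀*_ = Star _≡₀_

  NotIn : T → List T → Set
  NotIn t ρ = ¬ (t ∈ ρ)

{-# OPTIONS --safe #-}
module Submission where

open import Defs
open import Data.List using (List; []; _∷_; _++_; [_]; map)
open import Data.List.Properties using (++-assoc; map-++)
open import Data.List.Relation.Unary.Any using (here; there)
open import Data.Nat using (_+_; _∸_; _≤_)
open import Data.Nat.ListAction using (sum)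
open import Data.Nat.ListAction.Properties using (sum-++)
open import Data.Nat.Properties
  using (+-comm; +-assoc; +-∸-comm; ∸-+-assoc; m+n≤o⇒m≤o; m+n≤o⇒m≤o∸n; m≤m+n; ≤-trans)
open import Data.Product using (_×_; _,_; ∃; proj₁; proj₂)
open import Function using (_∘_)
open import Relation.Binary.PropositionalEquality
  using (_≡_; refl; sym; trans; cong; cong₂; subst; subst₂; _≗_; module ≡-Reasoning)
open import Relation.Binary.Construct.Closure.ReflexiveTransitive using (ε; _◅_)

-- Induct on ρ₁ = u ρ.  After σ both t and u are enabled and t ≠ u, so by
-- binary-conflict-freeness the step {t, u} is enabled; hence σut is a firing
-- sequence and the induction hypothesis moves t in front of ρ.  Firing t and u
-- in either order reaches the marking of the step {t, u}, so σtuρρ₂ is a firing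
-- sequence as well, and the remaining transposition of t and u is one ≡₀ step.

+≤⇒≤∸ : ∀ a {b m} → a + b ≤ m → b ≤ m ∸ a
+≤⇒≤∸ a {b} {m} a+b≤m = m+n≤o⇒m≤o∸n b (subst (_≤ m) (+-comm a b) a+b≤m)

∸-+-sequential : ∀ a b {m} c d → a + b ≤ m → m ∸ a + c ∸ b + d ≡ m ∸ (a + b) + (c + d)
∸-+-sequential a b {m} c d a+b≤m = begin
  m ∸ a + c ∸ b + d     ≡⟨ cong (_+ d) (+-∸-comm c (+≤⇒≤∸ a a+b≤m)) ⟩
  m ∸ a ∸ b + c + d     ≡⟨ cong (λ x → x + c + d) (∸-+-assoc m a b) ⟩
  m ∸ (a + b) + c + d   ≡⟨ +-assoc (m ∸ (a + b)) c d ⟩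
  m ∸ (a + b) + (c + d) ∎
  where open ≡-Reasoning

module _ (N : Net) where
  open Net N

  preG-++ : ∀ G H s → preG N (G ++ H) s ≡ preG N G s + preG N H s
  preG-++ G H s =
    trans (cong sum (map-++ (λ t → Fin s t) G H)) (sum-++ (map (λ t → Fin s t) G) _)

  postG-++ : ∀ G H s → postG N (G ++ H) s ≡ postG N G s + postG N H s
  postG-++ G H s =
    trans (cong sum (map-++ (λ t → Fout t s) G H)) (sum-++ (map (λ t → Fout t s) G) _)

  preG-++-comm : ∀ G H s → preG N (G ++ H) s ≡ preG N (H ++ G) s
  preG-++-comm G H s =
    trans (preG-++ G H s) (trans (+-comm (preG N G s) _) (sym (preG-++ H G s)))

  postG-++-comm : ∀ G H s → postG N (G ++ H) s ≡ postG N (H ++ G) s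
  postG-++-comm G H s =
    trans (postG-++ G H s) (trans (+-comm (postG N G s) _) (sym (postG-++ H G s)))

  Enabled-++-comm : ∀ {M} G H → Enabled N M (G ++ H) → Enabled N M (H ++ G)
  Enabled-++-comm {M} G H en s = subst (_≤ M s) (preG-++-comm G H s) (en s)

  Enabled-++⇒+≤ : ∀ {M} G H → Enabled N M (G ++ H) → ∀ s → preG N G s + preG N H s ≤ M s
  Enabled-++⇒+≤ {M} G H en s = subst (_≤ M s) (preG-++ G H s) (en s)

  Enabled-++⁻ˡ : ∀ {M} G H → Enabled N M (G ++ H) → Enabled N M G
  Enabled-++⁻ˡ G H en s = m+n≤o⇒m≤o (preG N G s) (Enabled-++⇒+≤ G H en s)

  Enabled-++⇒Enabled-fire : ∀ {M} G H → Enabled N M (G ++ H) → Enabled N (fire N M G) H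
  Enabled-++⇒Enabled-fire G H en s =
    ≤-trans (+≤⇒≤∸ (preG N G s) (Enabled-++⇒+≤ G H en s)) (m≤m+n _ _)

  fire-fire : ∀ M G H → Enabled N M (G ++ H) → fire N (fire N M G) H ≗ fire N M (G ++ H)
  fire-fire M G H en s =
    trans (∸-+-sequential (preG N G s) (preG N H s) (postG N G s) (postG N H s)
                          (Enabled-++⇒+≤ G H en s))
          (sym (cong₂ (λ p q → M s ∸ p + q) (preG-++ G H s) (postG-++ G H s)))

  fire-++-comm : ∀ M G H → fire N M (G ++ H) ≗ fire N M (H ++ G)
  fire-++-comm M G H s =
    cong₂ (λ p q → M s ∸ p + q) (preG-++-comm G H s) (postG-++-comm G H s)

  fire-fire-comm : ∀ {M} t u → Enabled N M (t ∷ u ∷ []) →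
    fire N (fire N M [ t ]) [ u ] ≗ fire N (fire N M [ u ]) [ t ]
  fire-fire-comm {M} t u en s = begin
    fire N (fire N M [ t ]) [ u ] s ≡⟨ fire-fire M [ t ] [ u ] en s ⟩
    fire N M (t ∷ u ∷ []) s         ≡⟨ fire-++-comm M [ t ] [ u ] s ⟩
    fire N M (u ∷ t ∷ []) s         ≡⟨ fire-fire M [ u ] [ t ] (Enabled-++-comm [ t ] [ u ] en) s ⟨
    fire N (fire N M [ u ]) [ t ] s ∎
    where open ≡-Reasoning

  Fires-++⁻ : ∀ {M M'} σ τ → Fires N M (σ ++ τ) M' →
    ∃ λ M₁ → Fires N M σ M₁ × Fires N M₁ τ M'
  Fires-++⁻ []      τ run           = _ , done , run
  Fires-++⁻ (t ∷ σ) τ (step en run) with Fires-++⁻ σ τ run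
  ... | M₁ , runσ , runτ = M₁ , step en runσ , runτ

  Fires-++⁺ : ∀ {M M₁ M'} {σ τ} → Fires N M σ M₁ → Fires N M₁ τ M' → Fires N M (σ ++ τ) M'
  Fires-++⁺ done           runτ = runτ
  Fires-++⁺ (step en runσ) runτ = step en (Fires-++⁺ runσ runτ)

  Fires-deterministic : ∀ {M M₁ M₂ σ} → Fires N M σ M₁ → Fires N M σ M₂ → M₁ ≡ M₂
  Fires-deterministic done         done         = refl
  Fires-deterministic (step _ run) (step _ run') = Fires-deterministic run run'

  Fires-resp-≗ : ∀ {M M' M₁ σ} → M ≗ M' → Fires N M σ M₁ → ∃ (Fires N M' σ)
  Fires-resp-≗ M≗M' done = _ , done
  Fires-resp-≗ {σ = t ∷ _} M≗M' (step en run) =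
    let _ , run' = Fires-resp-≗ (cong (λ m → m ∸ preG N [ t ] _ + postG N [ t ] _) ∘ M≗M') run
    in _ , step (λ s → subst (preG N [ t ] s ≤_) (M≗M' s) (en s)) run'

  FS-++ : ∀ {σ τ M M'} → Fires N M₀ σ M → Fires N M τ M' → FS N (σ ++ τ)
  FS-++ runσ runτ = _ , Fires-++⁺ runσ runτ

  FS-Enabled-next : ∀ {σ t τ M} → Fires N M₀ σ M → FS N (σ ++ t ∷ τ) → Enabled N M [ t ]
  FS-Enabled-next {σ} runσ (_ , run) with Fires-++⁻ σ _ run
  ... | _ , runσ' , step en _ with Fires-deterministic runσ runσ'
  ... | refl = en

  FS-swap : ∀ {α t u β M} → Fires N M₀ α M → Enabled N M (t ∷ u ∷ []) →
    FS N (α ++ u ∷ t ∷ β) → FS N (α ++ t ∷ u ∷ β)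
  FS-swap {α} {t} {u} runα tu (_ , run) with Fires-++⁻ α _ run
  ... | _ , runα' , step _ (step _ runβ) with Fires-deterministic runα runα'
  ... | refl =
    let _ , runβ' = Fires-resp-≗ (sym ∘ fire-fire-comm t u tu) runβ
    in FS-++ runα (step (Enabled-++⁻ˡ [ t ] [ u ] tu)
                        (step (Enabled-++⇒Enabled-fire [ t ] [ u ] tu) runβ'))

lemma9 : (N : Net) → BinaryConflictFree N →
    (σ ρ₁ ρ₂ : List (Net.T N)) (t : Net.T N) → NotIn N t ρ₁ →
    FS N (σ ++ t ∷ []) → FS N (σ ++ ρ₁ ++ t ∷ ρ₂) →
    FS N (σ ++ t ∷ ρ₁ ++ ρ₂) × _≡₀*_ N (σ ++ t ∷ ρ₁ ++ ρ₂) (σ ++ ρ₁ ++ t ∷ ρ₂)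
lemma9 N bcf σ []      ρ₂ t t∉ρ₁ _ σtρ₂ = σtρ₂ , ε
lemma9 N bcf σ (u ∷ ρ) ρ₂ t t∉uρ σt@(_ , runσt) σuρtρ₂ with Fires-++⁻ N σ [ t ] runσt
... | Mσ , runσ , _ =
  σtuρρ₂ , swap σ t u (ρ ++ ρ₂) Mσ σtuρρ₂ σutρρ₂ runσ tu ◅ σutρρ₂≡₀*σuρtρ₂
  where
  t-enabled : Enabled N Mσ [ t ]
  t-enabled = FS-Enabled-next N runσ σt
  u-enabled : Enabled N Mσ [ u ]
  u-enabled = FS-Enabled-next N runσ σuρtρ₂
  tu : Enabled N Mσ (t ∷ u ∷ [])
  tu = bcf Mσ (σ , runσ) t u (t∉uρ ∘ here) t-enabled u-enabled
  σut : FS N ((σ ++ [ u ]) ++ [ t ])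
  σut = subst (FS N) (sym (++-assoc σ [ u ] [ t ]))
    (FS-++ N runσ (step u-enabled (step t-enabled-after-u done)))
    where
    t-enabled-after-u : Enabled N (fire N Mσ [ u ]) [ t ]
    t-enabled-after-u = Enabled-++⇒Enabled-fire N [ u ] [ t ] (Enabled-++-comm N [ t ] [ u ] tu)
  ih : FS N ((σ ++ [ u ]) ++ t ∷ ρ ++ ρ₂) ×
       _≡₀*_ N ((σ ++ [ u ]) ++ t ∷ ρ ++ ρ₂) ((σ ++ [ u ]) ++ ρ ++ t ∷ ρ₂)
  ih = lemma9 N bcf (σ ++ [ u ]) ρ ρ₂ t (t∉uρ ∘ there) σut
         (subst (FS N) (sym (++-assoc σ [ u ] (ρ ++ t ∷ ρ₂))) σuρtρ₂)
  σutρρ₂ : FS N (σ ++ u ∷ t ∷ ρ ++ ρ₂)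
  σutρρ₂ = subst (FS N) (++-assoc σ [ u ] (t ∷ ρ ++ ρ₂)) (proj₁ ih)
  σutρρ₂≡₀*σuρtρ₂ : _≡₀*_ N (σ ++ u ∷ t ∷ ρ ++ ρ₂) (σ ++ u ∷ ρ ++ t ∷ ρ₂)
  σutρρ₂≡₀*σuρtρ₂ = subst₂ (_≡₀*_ N) (++-assoc σ [ u ] _) (++-assoc σ [ u ] _) (proj₂ ih)
  σtuρρ₂ : FS N (σ ++ t ∷ u ∷ ρ ++ ρ₂)
  σtuρρ₂ = FS-swap N runσ tu σutρρ₂
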